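{- Let $q$ be a power of an odd prime with $q\equiv 1\pmod 3$, let $R$ be the graph defined below over $\mathbb F_q$, and let $\phi$ be an automorphism of $R$ with associated functions $\lambda_2,\lambda_3,\pi_2,\pi_3$ such that $\lambda_2(a)=a$ for all $a\in\mathbb F_q$. Then $\pi_2(a)=a$ for all $a\in\mathbb F_q$, and there exists $b\in\mathbb F_q$ such that $\lambda_3(r)=r-b$ and $\pi_3(r)=r+b$ for all $r\in\mathbb F_q$.
   Context: $R$ is the bipartite graph whose parts are the set of points $(p_1,p_2,p_3)\in\mathbb F_q^3$ and the set of lines $[l_1,l_2,l_3]\in\mathbb F_q^3$ (two disjoint copies of $\mathbb F_q^3$), where $(p_1,p_2,p_3)$ is adjacent to $[l_1,l_2,l_3]$ if and only if $p_2+l_2 = p_1l_1$ and $p_3+l_3 = p_1p_2l_1(p_1+p_2+p_1p_2)$. For such $q$, every automorphism $\phi$ of $R$ maps points to points and lines to lines, and there are functions $\lambda_1,\pi_1:\mathbb F_q^3\to\mathbb F_q$ and $\lambda_2,\lambda_3,\pi_2,\pi_3:\mathbb F_q\to\mathbb F_q$ (depending on $\phi$) with $\phi([x,y,z])=[\lambda_1(x,y,z),\lambda_2(y),\lambda_3(z)]$ and $\phi((x,y,z))=(\pi_1(x,y,z),\pi_2(y),\pi_3(z))$ for all $x,y,z\in\mathbb F_q$. -}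

module Defs where

open import Level using (0ℓ)
open import Data.Nat using (ℕ)
open import Data.Fin using (Fin)
open import Data.Product using (_×_; _,_; ∃)
open import Data.Sum using (_⊎_; inj₁; inj₂)
open import Data.Empty using (⊥)
open import Relation.Binary.PropositionalEquality using (_≡_; _≢_)
open import Relation.Nullary using (¬_)
open import Algebra.Structures using (IsCommutativeRing)
open import Function.Bundles using (_↔_; _⇔_)

record FiniteField : Set₁ where
  infixl 6 _+_
  infixl 7 _*_
  field
    Carrier  : Set
    _+_ _*_  : Carrier → Carrier → Carrier
    -_       : Carrier → Carrier
    0# 1#    : Carrier
    isCommutativeRing : IsCommutativeRing _≡_ _+_ _*_ -_ 0# 1#
    0≢1      : 0# ≢ 1#
    inverse  : ∀ x → x ≢ 0# → ∃ λ y → x * y ≡ 1#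
    size     : ℕ
    enumeration : Carrier ↔ Fin size

  _-_ : Carrier → Carrier → Carrier
  x - y = x + (- y)

module RGraph (F : FiniteField) where
  open FiniteField F

  Triple : Set
  Triple = Carrier × Carrier × Carrier

  -- vertices: inj₁ = points (p₁,p₂,p₃), inj₂ = lines [l₁,l₂,l₃]
  Vertex : Set
  Vertex = Triple ⊎ Triple

  Incident : Triple → Triple → Set
  Incident (p₁ , p₂ , p₃) (l₁ , l₂ , l₃) =
    (p₂ + l₂ ≡ p₁ * l₁) × (p₃ + l₃ ≡ p₁ * p₂ * l₁ * (p₁ + p₂ + p₁ * p₂))

  Adj : Vertex → Vertex → Set
  Adj (inj₁ p) (inj₂ l) = Incident p l
  Adj (inj₂ l) (inj₁ p) = Incident p l
  Adj (inj₁ _) (inj₁ _) = ⊥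
  Adj (inj₂ _) (inj₂ _) = ⊥

  record Automorphism : Set where
    field
      bij : Vertex ↔ Vertex
    open Function.Bundles.Inverse bij public using (to)
    field
      preserves : ∀ u v → Adj u v ⇔ Adj (to u) (to v)

module Submission where

-- The lines [t, −y, 0], t ∈ F_q, all pass through (0, y, 0).  Their images share λ₂ and λ₃ but
-- have pairwise distinct first coordinates (φ is injective), and they all pass through the image
-- of (0, y, 0); this forces that image to have first coordinate 0, i.e. π₂ y + λ₂ (−y) = 0.
-- Hence λ₂ = id gives π₂ = id.  For points with second coordinate −1 the factor p₁ + p₂ + p₁p₂
-- collapses to −1, and incidence becomes l₂ − 1 = p₁l₁ together with p₃ + l₃ = l₂ − 1; as φ now
-- fixes second coordinates, this transports to π₃ p + λ₃ l = p + l, which makes π₃ and λ₃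
-- opposite translations.

open import Defs
open import Data.Nat using (ℕ; _^_; _%_)
open import Data.Nat.Primality using (Prime)
open import Data.Product using (_×_; _,_; ∃; proj₁; proj₂)
open import Data.Sum using (inj₁; inj₂)
open import Function.Base using (_∘_)
open import Function.Bundles using (_⇔_; mk⇔; Equivalence; Injection)
open import Function.Properties.Inverse using (↔⇒↣)
open import Level using (0ℓ)
open import Relation.Binary.PropositionalEquality
  using (_≡_; _≢_; refl; sym; trans; cong; subst; subst₂; module ≡-Reasoning)
open import Algebra.Bundles using (CommutativeRing)

module FieldArithmetic (F : FiniteField) where
  open FiniteField F
  open ≡-Reasoning

  -- FiniteField._-_ has no fixity declaration, so it binds tighter than _+_ and _*_.

  commutativeRing : CommutativeRing 0ℓ 0ℓ
  commutativeRing = record { isCommutativeRing = isCommutativeRing }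

  open CommutativeRing commutativeRing
    using (+-comm; +-identityˡ; +-identityʳ; *-comm; *-assoc; *-identityʳ; zeroˡ; ring; +-group; +-abelianGroup)
  open import Algebra.Properties.Ring ring using (-1*x≈-x; -‿distribˡ-*; x[y-z]≈xy-xz)
  open import Algebra.Properties.Group +-group
    using (x∙y⁻¹≈ε⇒x≈y; x≈y⇒x∙y⁻¹≈ε; ⁻¹-involutive; //-rightDividesˡ; //-rightDividesʳ)
  open import Algebra.Properties.AbelianGroup +-abelianGroup using (xyx⁻¹≈y)

  x*-1≡-x : ∀ x → x * - 1# ≡ - x
  x*-1≡-x x = trans (*-comm x (- 1#)) (-1*x≈-x x)

  x*-1*y*[x-1-x]≡x*y : ∀ x y → x * - 1# * y * (x + - 1# + x * - 1#) ≡ x * y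
  x*-1*y*[x-1-x]≡x*y x y = begin
    x * - 1# * y * (x + - 1# + x * - 1#) ≡⟨ cong (λ u → u * y * (x + - 1# + u)) (x*-1≡-x x) ⟩
    - x * y * (x + - 1# + - x)           ≡⟨ cong (- x * y *_) (xyx⁻¹≈y x (- 1#)) ⟩
    - x * y * - 1#                       ≡⟨ x*-1≡-x (- x * y) ⟩
    - (- x * y)                          ≡⟨ cong -_ (-‿distribˡ-* x y) ⟨
    - (- (x * y))                        ≡⟨ ⁻¹-involutive (x * y) ⟩
    x * y                                ∎

  x*y≡x*z∧y≢z⇒x≡0 : ∀ {x y z} → x * y ≡ x * z → y ≢ z → x ≡ 0#
  x*y≡x*z∧y≢z⇒x≡0 {x} {y} {z} xy≡xz y≢z with inverse (y - z) (λ y-z≡0 → y≢z (x∙y⁻¹≈ε⇒x≈y y z y-z≡0))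
  ... | w , [y-z]w≡1 = begin
    x                       ≡⟨ *-identityʳ x ⟨
    x * 1#                  ≡⟨ cong (x *_) [y-z]w≡1 ⟨
    x * ((y - z) * w)       ≡⟨ *-assoc x (y - z) w ⟨
    x * (y - z) * w         ≡⟨ cong (_* w) (x[y-z]≈xy-xz x y z) ⟩
    ((x * y) - (x * z)) * w ≡⟨ cong (_* w) (x≈y⇒x∙y⁻¹≈ε xy≡xz) ⟩
    0# * w                  ≡⟨ zeroˡ w ⟩
    0#                      ∎

  opposite-translations : (f g : Carrier → Carrier) → (∀ p l → g p + f l ≡ p + l)
                        → ∃ λ b → ∀ r → (f r ≡ r - b) × (g r ≡ r + b)
  opposite-translations f g g+f≡+ = g 0# , λ r → f≡-b r , g≡+b r
    where
    f≡-b : ∀ r → f r ≡ r - g 0#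
    f≡-b r = begin
      f r                  ≡⟨ //-rightDividesʳ (g 0#) (f r) ⟨
      (f r + g 0#) - g 0#  ≡⟨ cong (_- g 0#) (+-comm (f r) (g 0#)) ⟩
      (g 0# + f r) - g 0#  ≡⟨ cong (_- g 0#) (g+f≡+ 0# r) ⟩
      (0# + r) - g 0#      ≡⟨ cong (_- g 0#) (+-identityˡ r) ⟩
      r - g 0#             ∎
    g≡+b : ∀ r → g r ≡ r + g 0#
    g≡+b r = begin
      g r                      ≡⟨ //-rightDividesˡ (g 0#) (g r) ⟨
      (g r - g 0#) + g 0#      ≡⟨ cong (λ u → g r + u + g 0#) (+-identityˡ (- g 0#)) ⟨
      g r + (0# - g 0#) + g 0# ≡⟨ cong (λ u → g r + u + g 0#) (f≡-b 0#) ⟨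
      g r + f 0# + g 0#        ≡⟨ cong (_+ g 0#) (g+f≡+ r 0#) ⟩
      r + 0# + g 0#            ≡⟨ cong (_+ g 0#) (+-identityʳ r) ⟩
      r + g 0#                 ∎

module Incidence (F : FiniteField) where
  open FiniteField F
  open FieldArithmetic F
  open CommutativeRing commutativeRing using (zeroˡ)
  open RGraph F

  incident-[0,y,z] : ∀ {y z m n l} → y + n ≡ 0# → z + l ≡ 0# → Incident (0# , y , z) (m , n , l)
  incident-[0,y,z] {y} {z} {m} {n} {l} y+n≡0 z+l≡0 =
    trans y+n≡0 (sym (zeroˡ m)) , trans z+l≡0 (sym 0*y*m*t≡0)
    where
    0*y*m*t≡0 : 0# * y * m * (0# + y + 0# * y) ≡ 0#
    0*y*m*t≡0 = trans (cong (λ u → u * m * (0# + y + u)) (zeroˡ y))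
                      (trans (cong (_* (0# + y + 0#)) (zeroˡ m)) (zeroˡ _))

  incident-[x,-1,p] : ∀ {x p m n l}
                    → Incident (x , - 1# , p) (m , n , l) ⇔ ((- 1# + n ≡ x * m) × (p + l ≡ - 1# + n))
  incident-[x,-1,p] {x} {p} {m} {n} {l} = mk⇔
    (λ (n-1≡xm , p+l≡cubic) → n-1≡xm , trans p+l≡cubic (trans (x*-1*y*[x-1-x]≡x*y x m) (sym n-1≡xm)))
    (λ (n-1≡xm , p+l≡n-1) → n-1≡xm , trans p+l≡n-1 (trans n-1≡xm (sym (x*-1*y*[x-1-x]≡x*y x m))))

module CoordinatewiseAutomorphism
  (F : FiniteField) (φ : RGraph.Automorphism F)
  (λ₁ π₁ : FiniteField.Carrier F → FiniteField.Carrier F → FiniteField.Carrier F → FiniteField.Carrier F)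
  (λ₂ λ₃ π₂ π₃ : FiniteField.Carrier F → FiniteField.Carrier F)
  (φ-line : ∀ x y z → RGraph.Automorphism.to φ (inj₂ (x , y , z)) ≡ inj₂ (λ₁ x y z , λ₂ y , λ₃ z))
  (φ-point : ∀ x y z → RGraph.Automorphism.to φ (inj₁ (x , y , z)) ≡ inj₁ (π₁ x y z , π₂ y , π₃ z))
  where

  open FiniteField F
  open FieldArithmetic F
  open CommutativeRing commutativeRing using (*-identityˡ; +-identityʳ; -‿inverseʳ; zeroˡ; +-group)
  open import Algebra.Properties.Group +-group using (x∙y⁻¹≈ε⇒x≈y; \\-leftDividesʳ)
  open Incidence F
  open RGraph F
  open Automorphism φ
  open ≡-Reasoning

  pointImage : Triple → Triple
  pointImage (x , y , z) = π₁ x y z , π₂ y , π₃ z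

  lineImage : Triple → Triple
  lineImage (x , y , z) = λ₁ x y z , λ₂ y , λ₃ z

  image-incident : ∀ {P L} → Incident P L → Incident (pointImage P) (lineImage L)
  image-incident {P@(x , y , z)} {L@(x' , y' , z')} =
    subst₂ Adj (φ-point x y z) (φ-line x' y' z') ∘ Equivalence.to (preserves (inj₁ P) (inj₂ L))

  λ₁-injectiveˡ : ∀ {x x' y z} → λ₁ x y z ≡ λ₁ x' y z → x ≡ x'
  λ₁-injectiveˡ {x} {x'} {y} {z} λ₁≡ with Injection.injective (↔⇒↣ bij)
    (trans (φ-line x y z) (trans (cong (λ u → inj₂ (u , λ₂ y , λ₃ z)) λ₁≡) (sym (φ-line x' y z))))
  ... | refl = refl

  π₂+λ₂∘-≡0 : ∀ y → π₂ y + λ₂ (- y) ≡ 0#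
  π₂+λ₂∘-≡0 y = begin
    π₂ y + λ₂ (- y)      ≡⟨ through 0# ⟩
    a * λ₁ 0# (- y) 0#   ≡⟨ cong (_* λ₁ 0# (- y) 0#) a≡0 ⟩
    0# * λ₁ 0# (- y) 0#  ≡⟨ zeroˡ _ ⟩
    0#                   ∎
    where
    a : Carrier
    a = π₁ 0# y 0#
    through : ∀ t → π₂ y + λ₂ (- y) ≡ a * λ₁ t (- y) 0#
    through t = proj₁ (image-incident (incident-[0,y,z] {m = t} (-‿inverseʳ y) (+-identityʳ 0#)))
    a≡0 : a ≡ 0#
    a≡0 = x*y≡x*z∧y≢z⇒x≡0 (trans (sym (through 0#)) (through 1#)) (0≢1 ∘ λ₁-injectiveˡ)

  π₂≗id : (∀ a → λ₂ a ≡ a) → ∀ y → π₂ y ≡ y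
  π₂≗id λ₂≗id y = x∙y⁻¹≈ε⇒x≈y (π₂ y) y (trans (cong (π₂ y +_) (sym (λ₂≗id (- y)))) (π₂+λ₂∘-≡0 y))

  π₃+λ₃≡+ : (∀ a → λ₂ a ≡ a) → ∀ p l → π₃ p + λ₃ l ≡ p + l
  π₃+λ₃≡+ λ₂≗id p l = begin
    π₃ p + λ₃ l         ≡⟨ proj₂ (Equivalence.to incident-[x,-1,p] image) ⟩
    - 1# + λ₂ (1# + s)  ≡⟨ cong (- 1# +_) (λ₂≗id (1# + s)) ⟩
    - 1# + (1# + s)     ≡⟨ \\-leftDividesʳ 1# s ⟩
    s                   ∎
    where
    s : Carrier
    s = p + l
    incident : Incident (1# , - 1# , p) (s , 1# + s , l)
    incident = Equivalence.from incident-[x,-1,p]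
      (trans (\\-leftDividesʳ 1# s) (sym (*-identityˡ s)) , sym (\\-leftDividesʳ 1# s))
    image : Incident (π₁ 1# (- 1#) p , - 1# , π₃ p) (lineImage (s , 1# + s , l))
    image = subst (λ u → Incident (π₁ 1# (- 1#) p , u , π₃ p) (lineImage (s , 1# + s , l)))
                  (π₂≗id λ₂≗id (- 1#)) (image-incident incident)

lemma4p9 : (F : FiniteField) → (p k : ℕ) → Prime p → p ≢ 2
    → FiniteField.size F ≡ p ^ k → FiniteField.size F % 3 ≡ 1
    → (φ : RGraph.Automorphism F)
    → (λ₁ π₁ : FiniteField.Carrier F → FiniteField.Carrier F → FiniteField.Carrier F → FiniteField.Carrier F)
    → (λ₂ λ₃ π₂ π₃ : FiniteField.Carrier F → FiniteField.Carrier F)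
    → (∀ x y z → RGraph.Automorphism.to φ (inj₂ (x , y , z)) ≡ inj₂ (λ₁ x y z , λ₂ y , λ₃ z))
    → (∀ x y z → RGraph.Automorphism.to φ (inj₁ (x , y , z)) ≡ inj₁ (π₁ x y z , π₂ y , π₃ z))
    → (∀ a → λ₂ a ≡ a)
    → (∀ a → π₂ a ≡ a)
    × ∃ λ b → ∀ r → (λ₃ r ≡ FiniteField._-_ F r b) × (π₃ r ≡ FiniteField._+_ F r b)
lemma4p9 F _ _ _ _ _ _ φ λ₁ π₁ λ₂ λ₃ π₂ π₃ φ-line φ-point λ₂≗id =
  π₂≗id λ₂≗id , opposite-translations λ₃ π₃ (π₃+λ₃≡+ λ₂≗id)
  where
  open FieldArithmetic F using (opposite-translations)
  open CoordinatewiseAutomorphism F φ λ₁ π₁ λ₂ λ₃ π₂ π₃ φ-line φ-point using (π₂≗id; π₃+λ₃≡+)
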